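{- Let $n,k_1,k_2,t$ be positive integers with $k_1\geq k_2\geq t+1$ and $n\geq\max\{t+1,k_2-t\}\cdot(t+1)(k_1-t+1)(k_2-t+1)+t+1$. If $k_2=2t$, $t\geq 2$ and $(k_1,k_2)\neq(4,4)$, then $g_2(k_1,k_2,n,t)>g_1(k_1,k_2,n,t)$.
   Context: Binomial coefficients $\binom{a}{b}$ are $0$ when $b<0$ or $b>a$. $g_1(k,\ell,n,t)=\left(\binom{n-t}{k-t}-\binom{n-\ell-1}{k-t}\right)\left(\binom{n-t}{\ell-t}+t\right)$, $g_2(k,\ell,n,t)=\binom{n-t-1}{k-t-1}\left((t+1)\binom{n-t-1}{\ell-t}+\binom{n-t-1}{\ell-t-1}\right)$. -}

module Defs where

open import Data.Nat using (ℕ)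
open import Data.Nat.Combinatorics using (_C_)
open import Data.Integer using (ℤ; +_; -[1+_]; _+_; _-_; _*_)

-- Binomial coefficient with integer arguments: 0 when b < 0 or b > a
-- (for a ≥ 0 the stdlib's  _C_  is already 0 when b > a); 0 also when a < 0.
binom : ℤ → ℤ → ℤ
binom (+ a) (+ b) = + (a C b)
binom (+ a) -[1+ _ ] = + 0
binom -[1+ _ ] _ = + 0

g₁ : ℤ → ℤ → ℤ → ℤ → ℤ
g₁ k ℓ n t = (binom (n - t) (k - t) - binom (n - ℓ - + 1) (k - t))
             * (binom (n - t) (ℓ - t) + t)

g₂ : ℤ → ℤ → ℤ → ℤ → ℤ
g₂ k ℓ n t = binom (n - t - + 1) (k - t - + 1)
             * ((t + + 1) * binom (n - t - + 1) (ℓ - t) + binom (n - t - + 1) (ℓ - t - + 1))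

-- Write N = n − t − 1, m = n − 2t − 1 and a = k₁ − t − 1.  By the hockey-stick identity
-- C(N+1, a+1) − C(m, a+1) = S := Σ_{i ≤ t} C(m+i, a), and C(N+1, t) = X + Y with X = C(N, t),
-- Y = C(N, t−1); so g₁ = S(Y + X + t) and g₂ = B((t+1)X + Y) with B = C(N, a).  Every term of S
-- falls short of B by a multiple of F = C(m, a−1), whence 2S + t(t+1)F ≤ 2(t+1)B, and the claim
-- follows once 2B(Y + t + 1) ≤ (t+1)FX.  The ratio of the two sides of this last inequality tends
-- to a(t+1)/(2t) > 1 because a ≥ 2 (this is where (k₁, k₂) ≠ (4, 4) enters); absorption identities
-- turn it into a polynomial inequality in m that holds above the given threshold.
module Submission where

open import Defs
open import Data.Nat using (ℕ; _+_; _*_; _≤_; _≥_; _⊔_; _∸_)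
open import Data.Product using (_×_)
open import Relation.Nullary using (¬_)
open import Relation.Binary.PropositionalEquality using (_≡_)
open import Data.Integer using (+_) renaming (_<_ to _<ℤ_)

open import Data.Nat using (zero; suc; _<_; s≤s; z≤n; z<s)
open import Data.Nat.Properties
open import Data.Nat.Combinatorics using (_C_; nC1≡n; nCk+nC[k+1]≡[n+1]C[k+1])
open import Data.Nat.Tactic.RingSolver using (solve-∀)
import Data.Integer as ℤ
import Data.Integer.Properties as ℤ
open import Data.Product using (_,_; proj₁; proj₂; ∃)
open import Relation.Binary.PropositionalEquality
  using (refl; sym; trans; cong; cong₂; subst; subst₂; module ≡-Reasoning)

[1+k]*[1+n]C[1+k]≡[1+n]*nCk : ∀ n k → suc k * (suc n C suc k) ≡ suc n * (n C k)
[1+k]*[1+n]C[1+k]≡[1+n]*nCk zero    zero    = refl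
[1+k]*[1+n]C[1+k]≡[1+n]*nCk zero    (suc k) = *-zeroʳ (suc (suc k))
[1+k]*[1+n]C[1+k]≡[1+n]*nCk (suc n) zero    =
  trans (+-identityʳ _) (trans (nC1≡n (suc (suc n))) (sym (*-identityʳ (suc (suc n)))))
[1+k]*[1+n]C[1+k]≡[1+n]*nCk (suc n) (suc k) = begin
    suc (suc k) * (suc (suc n) C suc (suc k))
  ≡⟨ cong (suc (suc k) *_) (sym (nCk+nC[k+1]≡[n+1]C[k+1] (suc n) (suc k))) ⟩
    suc (suc k) * (x + y)
  ≡⟨ *-distribˡ-+ (suc (suc k)) x y ⟩
    (x + suc k * x) + suc (suc k) * y
  ≡⟨ cong₂ (λ p q → x + p + q) ([1+k]*[1+n]C[1+k]≡[1+n]*nCk n k) ([1+k]*[1+n]C[1+k]≡[1+n]*nCk n (suc k)) ⟩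
    (x + suc n * (n C k)) + suc n * (n C suc k)
  ≡⟨ +-assoc x _ _ ⟩
    x + (suc n * (n C k) + suc n * (n C suc k))
  ≡⟨ cong (λ z → x + z) (sym (*-distribˡ-+ (suc n) (n C k) (n C suc k))) ⟩
    x + suc n * (n C k + n C suc k)
  ≡⟨ cong (λ z → x + suc n * z) (nCk+nC[k+1]≡[n+1]C[k+1] n k) ⟩
    suc (suc n) * x
  ∎
  where
  open ≡-Reasoning
  x y : ℕ
  x = suc n C suc k
  y = suc n C suc (suc k)

[1+k]*nC[1+k]+k*nCk≡n*nCk : ∀ n k → suc k * (n C suc k) + k * (n C k) ≡ n * (n C k)
[1+k]*nC[1+k]+k*nCk≡n*nCk zero    zero    = refl
[1+k]*nC[1+k]+k*nCk≡n*nCk zero    (suc k) = cong₂ _+_ (*-zeroʳ (suc (suc k))) (*-zeroʳ (suc k))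
[1+k]*nC[1+k]+k*nCk≡n*nCk (suc n) zero    =
  trans (+-identityʳ _) (trans (+-identityʳ _) (trans (nC1≡n (suc n)) (sym (*-identityʳ (suc n)))))
[1+k]*nC[1+k]+k*nCk≡n*nCk (suc n) (suc k) = begin
    suc (suc k) * (suc n C suc (suc k)) + suc k * (suc n C suc k)
  ≡⟨ cong₂ _+_ ([1+k]*[1+n]C[1+k]≡[1+n]*nCk n (suc k)) ([1+k]*[1+n]C[1+k]≡[1+n]*nCk n k) ⟩
    suc n * (n C suc k) + suc n * (n C k)
  ≡⟨ sym (*-distribˡ-+ (suc n) (n C suc k) (n C k)) ⟩
    suc n * (n C suc k + n C k)
  ≡⟨ cong (suc n *_) (trans (+-comm (n C suc k) (n C k)) (nCk+nC[k+1]≡[n+1]C[k+1] n k)) ⟩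
    suc n * (suc n C suc k)
  ∎
  where open ≡-Reasoning

mCk≤[j+m]Ck : ∀ m j k → m C k ≤ (j + m) C k
mCk≤[j+m]Ck m zero    k       = ≤-refl
mCk≤[j+m]Ck m (suc j) zero    = ≤-refl
mCk≤[j+m]Ck m (suc j) (suc k) = begin
  m C suc k                           ≤⟨ mCk≤[j+m]Ck m j (suc k) ⟩
  (j + m) C suc k                     ≤⟨ m≤n+m _ _ ⟩
  (j + m) C k + (j + m) C suc k       ≡⟨ nCk+nC[k+1]≡[n+1]C[k+1] (j + m) k ⟩
  (suc j + m) C suc k                 ∎
  where open ≤-Reasoning

0<[k+m]Ck : ∀ m k → 0 < (k + m) C k
0<[k+m]Ck m zero    = s≤s z≤n
0<[k+m]Ck m (suc k) = begin-strict
  0                                   <⟨ 0<[k+m]Ck m k ⟩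
  (k + m) C k                         ≤⟨ m≤m+n _ _ ⟩
  (k + m) C k + (k + m) C suc k       ≡⟨ nCk+nC[k+1]≡[n+1]C[k+1] (k + m) k ⟩
  (suc k + m) C suc k                 ∎
  where open ≤-Reasoning

n≤nCk : ∀ k m → suc (suc k + m) ≤ suc (suc k + m) C suc k
n≤nCk zero    m = ≤-reflexive (sym (nC1≡n (suc (suc m))))
n≤nCk (suc k) m = begin
  suc (suc (suc k) + m)                                  ≡⟨ +-comm 1 _ ⟩
  suc (suc k + m) + 1                                    ≤⟨ +-mono-≤ (n≤nCk k m) (0<[k+m]Ck m (suc (suc k))) ⟩
  suc (suc k + m) C suc k + suc (suc k + m) C suc (suc k) ≡⟨ nCk+nC[k+1]≡[n+1]C[k+1] (suc (suc k + m)) (suc k) ⟩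
  suc (suc (suc k) + m) C suc (suc k)                    ∎
  where open ≤-Reasoning

columnSum : ℕ → ℕ → ℕ → ℕ
columnSum m c zero    = m C c
columnSum m c (suc j) = columnSum m c j + (suc j + m) C c

hockey-stick : ∀ m c j → suc (j + m) C suc c ≡ columnSum m c j + m C suc c
hockey-stick m c zero    = sym (nCk+nC[k+1]≡[n+1]C[k+1] m c)
hockey-stick m c (suc j) = begin
    suc (suc j + m) C suc c
  ≡⟨ sym (nCk+nC[k+1]≡[n+1]C[k+1] (suc j + m) c) ⟩
    (suc j + m) C c + suc (j + m) C suc c
  ≡⟨ cong (λ z → (suc j + m) C c + z) (hockey-stick m c j) ⟩
    (suc j + m) C c + (columnSum m c j + m C suc c)
  ≡⟨ sym (+-assoc ((suc j + m) C c) (columnSum m c j) (m C suc c)) ⟩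
    ((suc j + m) C c + columnSum m c j) + m C suc c
  ≡⟨ cong (λ z → z + m C suc c) (+-comm ((suc j + m) C c) (columnSum m c j)) ⟩
    columnSum m c (suc j) + m C suc c
  ∎
  where open ≡-Reasoning

columnSum-≤ : ∀ m c j → columnSum m c j ≤ suc j * ((j + m) C c)
columnSum-≤ m c zero    = ≤-reflexive (sym (+-identityʳ (m C c)))
columnSum-≤ m c (suc j) = begin
  columnSum m c j + P        ≤⟨ +-monoˡ-≤ P (columnSum-≤ m c j) ⟩
  suc j * ((j + m) C c) + P  ≤⟨ +-monoˡ-≤ P (*-monoʳ-≤ (suc j) (mCk≤[j+m]Ck (j + m) 1 c)) ⟩
  suc j * P + P              ≡⟨ +-comm (suc j * P) P ⟩
  suc (suc j) * P            ∎
  where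
  open ≤-Reasoning
  P : ℕ
  P = (suc j + m) C c

-- The i-th term of the sum falls short of the last one by at least (j - i) * (m C c).
columnSum-deficit : ∀ m c j →
  2 * columnSum m (suc c) j + j * suc j * (m C c) ≤ 2 * suc j * ((j + m) C suc c)
columnSum-deficit m c zero    = ≤-reflexive (+-identityʳ _)
columnSum-deficit m c (suc j) = begin
    2 * (S + P) + suc j * suc (suc j) * F
  ≡⟨ regroup S P F j ⟩
    (2 * S + j * suc j * F) + (2 * P + 2 * suc j * F)
  ≤⟨ +-monoˡ-≤ (2 * P + 2 * suc j * F) (columnSum-deficit m c j) ⟩
    2 * suc j * Q + (2 * P + 2 * suc j * F)
  ≤⟨ +-monoʳ-≤ (2 * suc j * Q) (+-monoʳ-≤ (2 * P) (*-monoʳ-≤ (2 * suc j) (mCk≤[j+m]Ck m j c))) ⟩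
    2 * suc j * Q + (2 * P + 2 * suc j * G)
  ≡⟨ cong (λ z → 2 * suc j * Q + (2 * z + 2 * suc j * G)) (sym pascal) ⟩
    2 * suc j * Q + (2 * (G + Q) + 2 * suc j * G)
  ≡⟨ collect Q G j ⟩
    2 * suc (suc j) * (G + Q)
  ≡⟨ cong (2 * suc (suc j) *_) pascal ⟩
    2 * suc (suc j) * P
  ∎
  where
  open ≤-Reasoning
  S P F G Q : ℕ
  S = columnSum m (suc c) j
  P = (suc j + m) C suc c
  F = m C c
  G = (j + m) C c
  Q = (j + m) C suc c
  pascal : G + Q ≡ P
  pascal = nCk+nC[k+1]≡[n+1]C[k+1] (j + m) c
  regroup : ∀ S P F j → 2 * (S + P) + suc j * suc (suc j) * F
                        ≡ (2 * S + j * suc j * F) + (2 * P + 2 * suc j * F)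
  regroup = solve-∀
  collect : ∀ Q G j → 2 * suc j * Q + (2 * (G + Q) + 2 * suc j * G) ≡ 2 * suc (suc j) * (G + Q)
  collect = solve-∀

-- Since (t + 1)(Y + X + t) = ((t + 1)X + Y) + t(Y + t + 1), the first hypothesis reduces
-- the claim to t · 2B(Y + t + 1) < t(t + 1)F(Y + X + t), which the second one gives.
g₁<g₂-criterion : ∀ S B F X Y s → let t = suc s in 0 < F →
  2 * S + t * suc t * F ≤ 2 * suc t * B →
  2 * B * (Y + suc t) ≤ suc t * F * X →
  S * (Y + X + t) < B * (suc t * X + Y)
g₁<g₂-criterion S B F X Y s (s≤s z≤n) sum-bound key =
  *-cancelˡ-< 2 (S * Z) (B * W) (+-cancelˡ-< (D * Z) (2 * (S * Z)) (2 * (B * W)) (begin-strict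
    D * Z + 2 * (S * Z)           ≡⟨ factor S D Z ⟩
    (2 * S + D) * Z               ≤⟨ *-monoˡ-≤ Z sum-bound ⟩
    2 * suc t * B * Z             ≡⟨ split B X Y s ⟩
    2 * (B * W) + t * (2 * B * (Y + suc t)) ≤⟨ +-monoʳ-≤ (2 * (B * W)) (*-monoʳ-≤ t key) ⟩
    2 * (B * W) + t * (suc t * F * X) ≡⟨ cong (λ z → 2 * (B * W) + z) (reassoc t F X) ⟩
    2 * (B * W) + D * X           <⟨ +-monoʳ-< (2 * (B * W)) (*-monoʳ-< D X<Z) ⟩
    2 * (B * W) + D * Z           ≡⟨ +-comm (2 * (B * W)) (D * Z) ⟩
    D * Z + 2 * (B * W)           ∎))
  where
  open ≤-Reasoning
  t Z W D : ℕ
  t = suc s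
  Z = Y + X + t
  W = suc t * X + Y
  D = t * suc t * F
  X<Z : X < Z
  X<Z = ≤-<-trans (m≤n+m X Y) (m<m+n (Y + X) z<s)
  factor : ∀ S D Z → D * Z + 2 * (S * Z) ≡ (2 * S + D) * Z
  factor = solve-∀
  split : ∀ B X Y s → 2 * suc (suc s) * B * (Y + X + suc s)
                      ≡ 2 * (B * (suc (suc s) * X + Y)) + suc s * (2 * B * (Y + suc (suc s)))
  split = solve-∀
  reassoc : ∀ t F X → t * (suc t * F * X) ≡ t * suc t * F * X
  reassoc = solve-∀

pos-minus : ∀ {x} y z → x ≡ y + z → + x ℤ.- + z ≡ + y
pos-minus y z refl =
  trans (ℤ.m-n≡m⊖n (y + z) z) (trans (ℤ.⊖-≥ (m≤n+m z y)) (cong +_ (m+n∸n≡m y z)))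

minus-one : ∀ {i} x → i ≡ + suc x → i ℤ.- + 1 ≡ + x
minus-one x refl = pos-minus x 1 (+-comm 1 x)

+[2*t]-+t≡+t : ∀ t → + (2 * t) ℤ.- + t ≡ + t
+[2*t]-+t≡+t t = pos-minus t t (cong (λ z → t + z) (+-identityʳ t))

g₁-unfold : ∀ k ℓ n t {A K A′ L} →
  n ℤ.- t ≡ A → k ℤ.- t ≡ K → n ℤ.- ℓ ℤ.- + 1 ≡ A′ → ℓ ℤ.- t ≡ L →
  g₁ k ℓ n t ≡ (binom A K ℤ.- binom A′ K) ℤ.* (binom A L ℤ.+ t)
g₁-unfold k ℓ n t refl refl refl refl = refl

g₂-unfold : ∀ k ℓ n t {A K L L′} →
  n ℤ.- t ℤ.- + 1 ≡ A → k ℤ.- t ℤ.- + 1 ≡ K → ℓ ℤ.- t ≡ L → ℓ ℤ.- t ℤ.- + 1 ≡ L′ →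
  g₂ k ℓ n t ≡ binom A K ℤ.* ((t ℤ.+ + 1) ℤ.* binom A L ℤ.+ binom A L′)
g₂-unfold k ℓ n t refl refl refl refl = refl

g₁-closed-form : ∀ m a s → let t = suc s ; N = t + m in
  g₁ (+ (suc a + t)) (+ (2 * t)) (+ (suc N + t)) (+ t) ≡ + (columnSum m a t * (N C s + N C t + t))
g₁-closed-form m a s = begin
    g₁ (+ (suc a + t)) (+ (2 * t)) (+ (suc N + t)) (+ t)
  ≡⟨ g₁-unfold (+ (suc a + t)) (+ (2 * t)) (+ (suc N + t)) (+ t)
               (pos-minus (suc N) t refl) (pos-minus (suc a) t refl)
               (minus-one m (pos-minus (suc m) (2 * t) n≡)) (+[2*t]-+t≡+t t) ⟩
    (+ (suc N C suc a) ℤ.- + (m C suc a)) ℤ.* (+ (suc N C t) ℤ.+ + t)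
  ≡⟨ cong₂ (λ i x → i ℤ.* (+ x ℤ.+ + t))
           (pos-minus S (m C suc a) (hockey-stick m a t)) (sym (nCk+nC[k+1]≡[n+1]C[k+1] N s)) ⟩
    + S ℤ.* (+ (N C s + N C t) ℤ.+ + t)
  ≡⟨ cong (λ i → + S ℤ.* i) (sym (ℤ.pos-+ (N C s + N C t) t)) ⟩
    + S ℤ.* + (N C s + N C t + t)
  ≡⟨ sym (ℤ.pos-* S (N C s + N C t + t)) ⟩
    + (S * (N C s + N C t + t))
  ∎
  where
  open ≡-Reasoning
  t N S : ℕ
  t = suc s
  N = t + m
  S = columnSum m a t
  n≡ : suc N + t ≡ suc m + 2 * t
  n≡ = rearrange m s
    where
    rearrange : ∀ m s → suc (suc s + m) + suc s ≡ suc m + 2 * suc s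
    rearrange = solve-∀

g₂-closed-form : ∀ m a s → let t = suc s ; N = t + m in
  g₂ (+ (suc a + t)) (+ (2 * t)) (+ (suc N + t)) (+ t) ≡ + ((N C a) * (suc t * (N C t) + N C s))
g₂-closed-form m a s = begin
    g₂ (+ (suc a + t)) (+ (2 * t)) (+ (suc N + t)) (+ t)
  ≡⟨ g₂-unfold (+ (suc a + t)) (+ (2 * t)) (+ (suc N + t)) (+ t)
               (minus-one N (pos-minus (suc N) t refl)) (minus-one a (pos-minus (suc a) t refl))
               (+[2*t]-+t≡+t t) (minus-one s (+[2*t]-+t≡+t t)) ⟩
    + B ℤ.* ((+ t ℤ.+ + 1) ℤ.* + X ℤ.+ + Y)
  ≡⟨ cong (λ i → + B ℤ.* (i ℤ.* + X ℤ.+ + Y)) (trans (sym (ℤ.pos-+ t 1)) (cong +_ (+-comm t 1))) ⟩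
    + B ℤ.* (+ suc t ℤ.* + X ℤ.+ + Y)
  ≡⟨ cong (λ i → + B ℤ.* (i ℤ.+ + Y)) (sym (ℤ.pos-* (suc t) X)) ⟩
    + B ℤ.* (+ (suc t * X) ℤ.+ + Y)
  ≡⟨ cong (λ i → + B ℤ.* i) (sym (ℤ.pos-+ (suc t * X) Y)) ⟩
    + B ℤ.* + (suc t * X + Y)
  ≡⟨ sym (ℤ.pos-* B (suc t * X + Y)) ⟩
    + (B * (suc t * X + Y))
  ∎
  where
  open ≡-Reasoning
  t N B X Y : ℕ
  t = suc s
  N = t + m
  B = N C a
  X = N C t
  Y = N C s

-- Here t = u + 2, k₁ = b + t + 2 and n = N + t + 1 = m + 2t + 1.  The parameter M is m − s·b,
-- so that M + s = (N − 1) − s·b needs no truncated subtraction.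
module KeyInequality (M u c : ℕ) where

  s t b m L N Δ : ℕ
  s = suc u
  t = suc s
  b = suc c
  m = M + s * b
  L = s + m
  N = t + m
  Δ = t + s * b

  B F X Y G H : ℕ
  B = N C suc b
  F = m C b
  X = N C t
  Y = N C s
  G = L C b
  H = (u + m) C c

  [1+b]*B≡N*G : suc b * B ≡ N * G
  [1+b]*B≡N*G = [1+k]*[1+n]C[1+k]≡[1+n]*nCk L b

  b*G≡L*H : b * G ≡ L * H
  b*G≡L*H = [1+k]*[1+n]C[1+k]≡[1+n]*nCk (u + m) c

  G≤F+s*H : G ≤ F + s * H
  G≤F+s*H = begin
    G                    ≡⟨ hockey-stick m c u ⟩
    columnSum m c u + F  ≤⟨ +-monoˡ-≤ F (columnSum-≤ m c u) ⟩
    s * H + F            ≡⟨ +-comm (s * H) F ⟩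
    F + s * H            ∎
    where open ≤-Reasoning

  [M+s]*G≤L*F : (M + s) * G ≤ L * F
  [M+s]*G≤L*F = +-cancelʳ-≤ (s * (b * G)) ((M + s) * G) (L * F) (begin
    (M + s) * G + s * (b * G)  ≡⟨ collect M s b G ⟩
    L * G                      ≤⟨ *-monoʳ-≤ L G≤F+s*H ⟩
    L * (F + s * H)            ≡⟨ distribute L F s H ⟩
    L * F + s * (L * H)        ≡⟨ cong (λ z → L * F + s * z) (sym b*G≡L*H) ⟩
    L * F + s * (b * G)        ∎)
    where
    open ≤-Reasoning
    collect : ∀ M s b G → (M + s) * G + s * (b * G) ≡ (s + (M + s * b)) * G
    collect = solve-∀
    distribute : ∀ L F s H → L * (F + s * H) ≡ L * F + s * (L * H)
    distribute = solve-∀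

  t*X≡[1+m]*Y : t * X ≡ suc m * Y
  t*X≡[1+m]*Y = +-cancelʳ-≡ (s * Y) (t * X) (suc m * Y)
    (trans ([1+k]*nC[1+k]+k*nCk≡n*nCk N s) (split s m Y))
    where
    split : ∀ s m Y → (suc s + m) * Y ≡ suc m * Y + s * Y
    split = solve-∀

  L*[Y+1+t]≤Y*[N+t] : L * (Y + suc t) ≤ Y * (N + t)
  L*[Y+1+t]≤Y*[N+t] = begin
    L * (Y + suc t)      ≡⟨ *-distribˡ-+ L Y (suc t) ⟩
    L * Y + L * suc t    ≤⟨ +-monoʳ-≤ (L * Y) (*-monoˡ-≤ (suc t) L≤Y) ⟩
    L * Y + Y * suc t    ≡⟨ collect L Y t ⟩
    Y * (N + t)          ∎
    where
    open ≤-Reasoning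
    L≤Y : L ≤ Y
    L≤Y = ≤-trans (n≤1+n L) (n≤nCk u m)
    collect : ∀ L Y t → L * Y + Y * suc t ≡ Y * (suc L + t)
    collect = solve-∀

  -- Since M ≥ 2t(3Δ + t) ≥ Δ + t, all lower-order terms of the left side fit into one extra M²,
  -- and 2t + 1 < (t + 1)(b + 1) because b ≥ 1.
  polynomial-bound : 2 * t * (3 * Δ + t) ≤ M → 2 * t * N * (N + t) ≤ suc t * suc b * (M + s) * suc m
  polynomial-bound large = begin
      2 * t * N * (N + t)
    ≡⟨ expand t M (s * b) ⟩
      2 * t * M * M + M * (2 * t * (2 * Δ + t)) + 2 * t * Δ * (Δ + t)
    ≤⟨ +-monoʳ-≤ (2 * t * M * M + M * (2 * t * (2 * Δ + t))) (*-monoʳ-≤ (2 * t * Δ) Δ+t≤M) ⟩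
      2 * t * M * M + M * (2 * t * (2 * Δ + t)) + 2 * t * Δ * M
    ≡⟨ collect t M Δ ⟩
      2 * t * M * M + M * (2 * t * (3 * Δ + t))
    ≤⟨ +-monoʳ-≤ (2 * t * M * M) (*-monoʳ-≤ M large) ⟩
      2 * t * M * M + M * M
    ≡⟨ square t M ⟩
      (2 * t + 1) * M * M
    ≤⟨ *-monoˡ-≤ M (*-monoˡ-≤ M 2t+1≤[1+t][1+b]) ⟩
      suc t * suc b * M * M
    ≤⟨ *-mono-≤ (*-monoʳ-≤ (suc t * suc b) (m≤m+n M s)) (≤-trans (m≤m+n M (s * b)) (n≤1+n m)) ⟩
      suc t * suc b * (M + s) * suc m
    ∎
    where
    open ≤-Reasoning
    Δ+t≤M : Δ + t ≤ M
    Δ+t≤M = ≤-trans (+-monoˡ-≤ t (m≤m+n Δ (2 * Δ)))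
                    (≤-trans (m≤n*m (3 * Δ + t) (2 * t)) large)
    2t+1≤[1+t][1+b] : 2 * t + 1 ≤ suc t * suc b
    2t+1≤[1+t][1+b] = ≤-trans (≤-trans (n≤1+n (2 * t + 1)) (≤-reflexive (double t)))
                              (*-monoʳ-≤ (suc t) (s≤s (s≤s z≤n)))
      where
      double : ∀ t → suc (2 * t + 1) ≡ suc t * 2
      double = solve-∀
    expand : ∀ t M sb → 2 * t * (t + (M + sb)) * (t + (M + sb) + t)
      ≡ 2 * t * M * M + M * (2 * t * (2 * (t + sb) + t)) + 2 * t * (t + sb) * (t + sb + t)
    expand = solve-∀
    collect : ∀ t M Δ → 2 * t * M * M + M * (2 * t * (2 * Δ + t)) + 2 * t * Δ * M
                        ≡ 2 * t * M * M + M * (2 * t * (3 * Δ + t))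
    collect = solve-∀
    square : ∀ t M → 2 * t * M * M + M * M ≡ (2 * t + 1) * M * M
    square = solve-∀

  2B[Y+1+t]≤[1+t]FX : 2 * t * (3 * Δ + t) ≤ M → 2 * B * (Y + suc t) ≤ suc t * F * X
  2B[Y+1+t]≤[1+t]FX large = *-cancelˡ-≤ K (begin
      K * (2 * B * (Y + suc t))
    ≡⟨ regroup₁ b t L B (Y + suc t) ⟩
      2 * t * (suc b * B) * (L * (Y + suc t))
    ≡⟨ cong (λ z → 2 * t * z * (L * (Y + suc t))) [1+b]*B≡N*G ⟩
      2 * t * (N * G) * (L * (Y + suc t))
    ≤⟨ *-monoʳ-≤ (2 * t * (N * G)) L*[Y+1+t]≤Y*[N+t] ⟩
      2 * t * (N * G) * (Y * (N + t))
    ≡⟨ regroup₂ t N G Y ⟩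
      2 * t * N * (N + t) * (G * Y)
    ≤⟨ *-monoˡ-≤ (G * Y) (polynomial-bound large) ⟩
      suc t * suc b * (M + s) * suc m * (G * Y)
    ≡⟨ regroup₃ (suc t * suc b) (M + s) (suc m) G Y ⟩
      suc t * suc b * ((M + s) * G) * (suc m * Y)
    ≤⟨ *-mono-≤ (*-monoʳ-≤ (suc t * suc b) [M+s]*G≤L*F) (≤-reflexive (sym t*X≡[1+m]*Y)) ⟩
      suc t * suc b * (L * F) * (t * X)
    ≡⟨ regroup₄ t b L F X ⟩
      K * (suc t * F * X)
    ∎)
    where
    open ≤-Reasoning
    K : ℕ
    K = suc b * t * L
    regroup₁ : ∀ b t L B Z → suc b * t * L * (2 * B * Z) ≡ 2 * t * (suc b * B) * (L * Z)
    regroup₁ = solve-∀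
    regroup₂ : ∀ t N G Y → 2 * t * (N * G) * (Y * (N + t)) ≡ 2 * t * N * (N + t) * (G * Y)
    regroup₂ = solve-∀
    regroup₃ : ∀ p P Q G Y → p * P * Q * (G * Y) ≡ p * (P * G) * (Q * Y)
    regroup₃ = solve-∀
    regroup₄ : ∀ t b L F X → suc t * suc b * (L * F) * (t * X) ≡ suc b * t * L * (suc t * F * X)
    regroup₄ = solve-∀

  g₁<g₂-in-ℕ : 2 * t * (3 * Δ + t) ≤ M → columnSum m (suc b) t * (Y + X + t) < B * (suc t * X + Y)
  g₁<g₂-in-ℕ large =
    g₁<g₂-criterion (columnSum m (suc b) t) B F X Y s 0<F
                    (columnSum-deficit m b t) (2B[Y+1+t]≤[1+t]FX large)
    where
    shift : ∀ M u b → b + (M + u * b) ≡ M + suc u * b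
    shift = solve-∀
    0<F : 0 < F
    0<F = subst (λ z → 0 < z C b) (shift M u b) (0<[k+m]Ck (M + u * b) b)

  g₁<g₂ : 2 * t * (3 * Δ + t) ≤ M →
    g₁ (+ (suc (suc b) + t)) (+ (2 * t)) (+ (suc N + t)) (+ t)
      <ℤ g₂ (+ (suc (suc b) + t)) (+ (2 * t)) (+ (suc N + t)) (+ t)
  g₁<g₂ large = subst₂ _<ℤ_ (sym (g₁-closed-form m (suc b) s)) (sym (g₂-closed-form m (suc b) s))
                             (ℤ.+<+ (g₁<g₂-in-ℕ large))

n-bound-suffices : ∀ u c → let s = suc u ; t = suc s ; b = suc c ; Δ = t + s * b in
  2 * t * (3 * Δ + t) + Δ ≤ (t + 1) * (t + 1) * (suc (suc b) + 1) * (t + 1)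
n-bound-suffices u c = ≤-trans (m≤m+n _ _) (≤-reflexive (sym (excess u c)))
  where
  excess : ∀ u c → (suc (suc u) + 1) * (suc (suc u) + 1) * (suc (suc (suc c)) + 1) * (suc (suc u) + 1)
    ≡ 2 * suc (suc u) * (3 * (suc (suc u) + suc u * suc c) + suc (suc u)) + (suc (suc u) + suc u * suc c)
      + (u * u * u * c + 3 * u * u * c + 8 * u * c + 14 * c + 4 * u * u * u + 22 * u * u + 56 * u + 61)
  excess = solve-∀

g₁<g₂-for-large-n : ∀ {n k₁} u c → let t = suc (suc u) ; a = suc (suc c) in
  k₁ ≡ suc a + t → (t + 1) * (t + 1) * (suc a + 1) * (t + 1) + t + 1 ≤ n →
  g₁ (+ k₁) (+ (2 * t)) (+ n) (+ t) <ℤ g₂ (+ k₁) (+ (2 * t)) (+ n) (+ t)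
g₁<g₂-for-large-n {n} u c refl n-large =
  subst (λ n → g₁ (+ k₁) (+ (2 * t)) (+ n) (+ t) <ℤ g₂ (+ k₁) (+ (2 * t)) (+ n) (+ t))
        (trans (shape M₀ r t (s * b)) (proj₂ n-split))
        (KeyInequality.g₁<g₂ (M₀ + r) u c (m≤m+n M₀ r))
  where
  s t b k₁ M₀ r : ℕ
  s = suc u
  t = suc s
  b = suc c
  k₁ = suc (suc b) + t
  M₀ = 2 * t * (3 * (t + s * b) + t)
  n-split : ∃ λ r → M₀ + (t + s * b) + t + 1 + r ≡ n
  n-split = m≤n⇒∃[o]m+o≡n (≤-trans (+-monoˡ-≤ 1 (+-monoˡ-≤ t (n-bound-suffices u c))) n-large)
  r = proj₁ n-split
  shape : ∀ M₀ r t sb → suc (t + (M₀ + r + sb)) + t ≡ M₀ + (t + sb) + t + 1 + r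
  shape = solve-∀

3+t≤k₁ : ∀ {k₁} u → let t = suc (suc u) in 2 * t ≤ k₁ → ¬ (k₁ ≡ 4 × 2 * t ≡ 4) → 3 + t ≤ k₁
3+t≤k₁ zero    4≤k₁ k₁≢4 = ≤∧≢⇒< 4≤k₁ (λ 4≡k₁ → k₁≢4 (sym 4≡k₁ , refl))
3+t≤k₁ (suc u) 2t≤k₁ _   =
  ≤-trans (≤-trans (≤-reflexive (+-comm 3 t)) (+-monoʳ-≤ t (s≤s (s≤s (s≤s z≤n))))) 2t≤k₁
  where
  t : ℕ
  t = suc (suc (suc u))

2*t∸t≡t : ∀ t → 2 * t ∸ t ≡ t
2*t∸t≡t t = trans (m+n∸m≡n t (t + 0)) (+-identityʳ t)

n-bound≡ : ∀ {k₁} t a → k₁ ≡ suc a + t →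
  ((t + 1) ⊔ (2 * t ∸ t)) * (t + 1) * (k₁ ∸ t + 1) * (2 * t ∸ t + 1) ≡ (t + 1) * (t + 1) * (suc a + 1) * (t + 1)
n-bound≡ t a refl rewrite m+n∸n≡m (suc a) t | 2*t∸t≡t t | m≥n⇒m⊔n≡m (m≤m+n t 1) = refl

lemma4p3 : (n k₁ k₂ t : ℕ) → 1 ≤ n → 1 ≤ k₁ → 1 ≤ k₂ → 1 ≤ t →
    k₁ ≥ k₂ → k₂ ≥ t + 1 →
    n ≥ ((t + 1) ⊔ (k₂ ∸ t)) * (t + 1) * (k₁ ∸ t + 1) * (k₂ ∸ t + 1) + t + 1 →
    k₂ ≡ 2 * t → t ≥ 2 → ¬ (k₁ ≡ 4 × k₂ ≡ 4) →
    g₁ (+ k₁) (+ k₂) (+ n) (+ t) <ℤ g₂ (+ k₁) (+ k₂) (+ n) (+ t)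
lemma4p3 n k₁ _ t _ _ _ _ 2t≤k₁ _ n-large refl (s≤s (s≤s {n = u} z≤n)) k₁≢4 =
  g₁<g₂-for-large-n u c k₁≡ (subst (λ T → T + t + 1 ≤ n) (n-bound≡ t (suc (suc c)) k₁≡) n-large)
  where
  k₁-split : ∃ λ c → 3 + t + c ≡ k₁
  k₁-split = m≤n⇒∃[o]m+o≡n (3+t≤k₁ u 2t≤k₁ k₁≢4)
  c : ℕ
  c = proj₁ k₁-split
  k₁≡ : k₁ ≡ 3 + c + t
  k₁≡ = trans (sym (proj₂ k₁-split)) (cong (λ z → 3 + z) (+-comm t c))
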